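{- Let $G=C_m\oplus C_{mn}$ with $n\ge 1$ and $m\ge 2$. Let $S$ be a minimal zero-sum sequence over $G$ of length $m+mn-1$ of the form \[ S=f_1^{sm-1}f_2^{(n-s)m+\epsilon}\prod_{i=1}^{m-\epsilon}(-x_if_1+f_2), \] where (a) $\{f_1,f_2\}$ is a generating set of $G$ with $\operatorname{ord}(f_2)=mn$ and $\operatorname{ord}(f_1)>m$; (b) $\epsilon\in[1,m-1]$ and $s\in[1,n-1]$; (c) $x_1,\dots,x_{m-\epsilon}\in[1,m-1]$ with $x_1+\ldots+x_{m-\epsilon}=m-1$; (d) either $s=1$ or $mf_1=mf_2$, with both holding when $n=2$; (e) either $\epsilon\ge 2$ or $mf_1\ne mf_2$. Suppose $T\mid S$ is a subsequence with $|T|\ge 2m-1$. Then $T$ contains a subsequence $T_1\mid T$ with $\sigma(T_1)=mf_2$. Furthermore, if $T$ has no proper subsequence with this property, then $T=f_1^{m-1}f_2^{\epsilon}\prod_{i=1}^{m-\epsilon}(-x_if_1+f_2)$.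
   Context: Sequences over $G$ are elements of the free abelian monoid $\mathcal F(G)$ (finite unordered lists with repetition, written multiplicatively; $g^k$ denotes $k$ copies of $g$). $T\mid S$ means $T$ is a subsequence (sub-multiset) of $S$; $|S|$ is the length and $\sigma(S)$ the sum of the terms. A minimal zero-sum sequence is a nonempty sequence with sum $0$ having no proper nonempty zero-sum subsequence. $C_k$ denotes a cyclic group of order $k$. -}

module Defs where

open import Data.Nat as ℕ using (ℕ; _<_; _≤_)
open import Data.Integer as ℤ using (ℤ; +_)
open import Data.Integer.Divisibility as ℤD using ()
open import Data.Fin using (Fin; toℕ)
open import Data.Product using (_×_; _,_; ∃; ∃-syntax; proj₁; proj₂)
open import Data.List using (List; []; _∷_; _++_)
open import Data.List.Relation.Binary.Permutation.Propositional using (_↭_)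
open import Relation.Nullary using (¬_)
open import Relation.Binary.PropositionalEquality using (_≡_)

-- The group G = C_m ⊕ C_{mn}, elements as canonical representatives
-- (a , b) with a ∈ [0, m-1], b ∈ [0, mn-1].
G : ℕ → ℕ → Set
G m n = Fin m × Fin (m ℕ.* n)

-- Integer pairs used to do arithmetic in G (modulo m, modulo mn).
ℤ² : Set
ℤ² = ℤ × ℤ

ι : ∀ {m n} → G m n → ℤ²
ι (a , b) = (+ toℕ a , + toℕ b)

0² : ℤ²
0² = (+ 0 , + 0)

_⊕_ : ℤ² → ℤ² → ℤ²
(a , b) ⊕ (c , d) = (a ℤ.+ c , b ℤ.+ d)

_•_ : ℤ → ℤ² → ℤ²
k • (a , b) = (k ℤ.* a , k ℤ.* b)

≈[_,_] : ℕ → ℕ → ℤ² → ℤ² → Set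
≈[ m , n ] (a , b) (c , d) = ((+ m) ℤD.∣ (a ℤ.- c)) × ((+ (m ℕ.* n)) ℤD.∣ (b ℤ.- d))

σ : ∀ {m n} → List (G m n) → ℤ²
σ [] = 0²
σ (g ∷ S) = ι g ⊕ σ S

_∣ˢ_ : ∀ {A : Set} → List A → List A → Set
T ∣ˢ S = ∃[ R ] ((T ++ R) ↭ S)

ZeroSum : ∀ m n → List (G m n) → Set
ZeroSum m n S = ≈[ m , n ] (σ S) 0²

MinimalZeroSum : ∀ m n → List (G m n) → Set
MinimalZeroSum m n S =
  ¬ (S ≡ []) × ZeroSum m n S ×
  (∀ T → T ∣ˢ S → ¬ (T ≡ []) → ZeroSum m n T → T ↭ S)

IsOrder : ∀ m n → G m n → ℕ → Set
IsOrder m n g k =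
  0 < k × ≈[ m , n ] ((+ k) • ι g) 0² ×
  (∀ j → 0 < j → j < k → ¬ ≈[ m , n ] ((+ j) • ι g) 0²)

Generates : ∀ m n → G m n → G m n → Set
Generates m n f₁ f₂ = ∀ (g : G m n) → ∃[ a ] ∃[ b ] ≈[ m , n ] (ι g) ((a • ι f₁) ⊕ (b • ι f₂))

-- Write T as f₁^a f₂^b U with U ⊆ gs, the elements of U being -yᵢ f₁ + f₂ for a
-- subfamily (yᵢ) of the xᵢ, and put c = |U|. Since all xᵢ ≥ 1 and Σ xᵢ = m - 1,
-- Σ yᵢ ≤ m - 1, with equality only when U = gs. If b + c < m, the bound |T| ≥ 2m - 1
-- forces a ≥ m, hence s ≠ 1 and m f₁ = m f₂, so f₁^m works. Otherwise take the first
-- k = m - b terms of U (k = 0 if b ≥ m): in f₁^(y₁+⋯+y_k) f₂^(m-k) (-y₁f₁+f₂)⋯(-y_kf₁+f₂)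
-- the f₁-coefficients cancel, so its sum is m f₂, and the length bound gives y₁+⋯+y_k ≤ a.
-- This subsequence is proper unless it is all of T, which pins a = m - 1, U = gs, b = ε.

module Submission where

open import Defs
open import Function using (_∘_)
open import Data.Empty using (⊥-elim)
open import Data.Nat using (ℕ; zero; suc; _+_; _*_; _∸_; _≤_; _<_; z≤n; s≤s)
open import Data.Nat.Properties
open import Data.Nat.ListAction using (sum)
open import Data.Nat.ListAction.Properties using (sum-++; sum-↭)
open import Data.Integer as ℤ using (ℤ; +_)
import Data.Integer.Properties as ℤₚ
import Data.Integer.Divisibility as ℤ∣
import Data.Integer.Divisibility.Signed as ℤ∣ₛ
open import Data.Integer.Tactic.RingSolver using (solve-∀)
open import Data.Product using (_×_; _,_; ∃; ∃₂; ∃-syntax; proj₁; proj₂)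
open import Data.Sum using (_⊎_; inj₁; inj₂; [_,_]′)
open import Data.List using (List; []; _∷_; length; replicate; _++_; take; drop)
open import Data.List.Properties
  using (++-identityʳ; length-++; length-replicate; length-take; length-drop; take++drop≡id; take-all)
open import Data.List.Relation.Unary.All as All using (All; []; _∷_)
open import Data.List.Relation.Unary.All.Properties using (drop⁺; ++⁻ʳ)
open import Data.List.Relation.Unary.Any using (here)
open import Data.List.Membership.Propositional.Properties using (∈-∃++)
open import Data.List.Relation.Binary.Pointwise as Pointwise using (Pointwise; []; _∷_; Pointwise-length)
open import Data.List.Relation.Binary.Equality.Propositional using (≋⇒≡)
open import Data.List.Relation.Binary.Sublist.Propositional
  using (_⊆_; []; _∷_; _∷ʳ_; minimum)
open import Data.List.Relation.Binary.Sublist.Propositional.Properties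
  using (++⁺; ++⁺ʳ; take-⊆; to-≋; length-mono-≤; All-resp-⊆)
open import Data.List.Relation.Binary.Permutation.Propositional
  using (_↭_; ↭-refl; ↭-sym; ↭-trans; ↭-prep; ↭-swap)
open import Data.List.Relation.Binary.Permutation.Propositional.Properties
  using (↭-length; ∈-resp-↭; drop-mid; shift; All-resp-↭)
open import Relation.Nullary using (¬_; yes; no)
open import Relation.Binary.PropositionalEquality
  using (_≡_; _≢_; refl; sym; trans; cong; cong₂; subst; subst₂; module ≡-Reasoning)

ModEq : ℕ → ℤ → ℤ → Set
ModEq k a b = + k ℤ∣.∣ a ℤ.- b

module _ (k : ℕ) where

  private
    signed : ∀ a b → ModEq k a b → + k ℤ∣ₛ.∣ a ℤ.- b
    signed a b = ℤ∣ₛ.∣ᵤ⇒∣ {i = a ℤ.- b}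

    unsigned : ∀ {x} y → + k ℤ∣ₛ.∣ x → x ≡ y → + k ℤ∣.∣ y
    unsigned _ k∣x refl = ℤ∣ₛ.∣⇒∣ᵤ k∣x

  ModEq-refl : ∀ a → ModEq k a a
  ModEq-refl a = unsigned (a ℤ.- a) (ℤ∣ₛ.∣n⇒∣m*n (+ 0) ℤ∣ₛ.∣-refl) (sym (ℤₚ.+-inverseʳ a))

  ModEq-trans : ∀ a b c → ModEq k a b → ModEq k b c → ModEq k a c
  ModEq-trans a b c a≡b b≡c =
    unsigned (a ℤ.- c) (ℤ∣ₛ.∣m∣n⇒∣m+n (signed a b a≡b) (signed b c b≡c)) (telescope a b c)
    where
      telescope : ∀ a b c → (a ℤ.- b) ℤ.+ (b ℤ.- c) ≡ a ℤ.- c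
      telescope = solve-∀

  ModEq-+ : ∀ a b c d → ModEq k a b → ModEq k c d → ModEq k (a ℤ.+ c) (b ℤ.+ d)
  ModEq-+ a b c d a≡b c≡d =
    unsigned ((a ℤ.+ c) ℤ.- (b ℤ.+ d)) (ℤ∣ₛ.∣m∣n⇒∣m+n (signed a b a≡b) (signed c d c≡d)) (regroup a b c d)
    where
      regroup : ∀ a b c d → (a ℤ.- b) ℤ.+ (c ℤ.- d) ≡ (a ℤ.+ c) ℤ.- (b ℤ.+ d)
      regroup = solve-∀

⊕-identityˡ : ∀ x → 0² ⊕ x ≡ x
⊕-identityˡ (x₁ , x₂) = cong₂ _,_ (ℤₚ.+-identityˡ x₁) (ℤₚ.+-identityˡ x₂)

⊕-assoc : ∀ x y z → (x ⊕ y) ⊕ z ≡ x ⊕ (y ⊕ z)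
⊕-assoc (x₁ , x₂) (y₁ , y₂) (z₁ , z₂) = cong₂ _,_ (ℤₚ.+-assoc x₁ y₁ z₁) (ℤₚ.+-assoc x₂ y₂ z₂)

•-suc : ∀ k x → (+ suc k) • x ≡ x ⊕ ((+ k) • x)
•-suc k (x₁ , x₂) = cong₂ _,_ (ℤₚ.suc-* (+ k) x₁) (ℤₚ.suc-* (+ k) x₂)

module _ (P Q : ℤ²) where

  ⊕-line : ∀ x y c → (((ℤ.- (+ x)) • P) ⊕ Q) ⊕ (((ℤ.- (+ y)) • P) ⊕ ((+ c) • Q))
                   ≡ ((ℤ.- (+ (x + y))) • P) ⊕ ((+ suc c) • Q)
  ⊕-line x y c =
    cong₂ _,_ (law (+ x) (+ y) (+ c) (proj₁ P) (proj₁ Q)) (law (+ x) (+ y) (+ c) (proj₂ P) (proj₂ Q))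
    where
      law : ∀ x y c p q → ((ℤ.- x) ℤ.* p ℤ.+ q) ℤ.+ ((ℤ.- y) ℤ.* p ℤ.+ c ℤ.* q)
                        ≡ (ℤ.- (x ℤ.+ y)) ℤ.* p ℤ.+ (+ 1 ℤ.+ c) ℤ.* q
      law = solve-∀

  ⊕-line-cancel : ∀ x b c → ((+ x) • P) ⊕ (((+ b) • Q) ⊕ (((ℤ.- (+ x)) • P) ⊕ ((+ c) • Q)))
                          ≡ (+ (b + c)) • Q
  ⊕-line-cancel x b c =
    cong₂ _,_ (law (+ x) (+ b) (+ c) (proj₁ P) (proj₁ Q)) (law (+ x) (+ b) (+ c) (proj₂ P) (proj₂ Q))
    where
      law : ∀ x b c p q → x ℤ.* p ℤ.+ (b ℤ.* q ℤ.+ ((ℤ.- x) ℤ.* p ℤ.+ c ℤ.* q)) ≡ (b ℤ.+ c) ℤ.* q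
      law = solve-∀

module Modulo (m n : ℕ) where

  -- A record rather than ≈[ m , n ] itself: that unfolds to divisibility of differences,
  -- from which Agda cannot infer the compared elements.
  infix 4 _≈_
  record _≈_ (x y : ℤ²) : Set where
    constructor mod
    field unmod : ≈[ m , n ] x y

  ≈-reflexive : ∀ {x y} → x ≡ y → x ≈ y
  ≈-reflexive {x} refl = mod (ModEq-refl m (proj₁ x) , ModEq-refl (m * n) (proj₂ x))

  ≈-trans : ∀ {x y z} → x ≈ y → y ≈ z → x ≈ z
  ≈-trans {x₁ , x₂} {y₁ , y₂} {z₁ , z₂} (mod (p₁ , p₂)) (mod (q₁ , q₂)) =
    mod (ModEq-trans m x₁ y₁ z₁ p₁ q₁ , ModEq-trans (m * n) x₂ y₂ z₂ p₂ q₂)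

  ⊕-cong : ∀ {x y u v} → x ≈ y → u ≈ v → x ⊕ u ≈ y ⊕ v
  ⊕-cong {x₁ , x₂} {y₁ , y₂} {u₁ , u₂} {v₁ , v₂} (mod (p₁ , p₂)) (mod (q₁ , q₂)) =
    mod (ModEq-+ m x₁ y₁ u₁ v₁ p₁ q₁ , ModEq-+ (m * n) x₂ y₂ u₂ v₂ p₂ q₂)

  ⊕-congˡ : ∀ x {u v} → u ≈ v → x ⊕ u ≈ x ⊕ v
  ⊕-congˡ x = ⊕-cong (≈-reflexive {x} refl)

  σ-++ : ∀ (A B : List (G m n)) → σ (A ++ B) ≡ σ A ⊕ σ B
  σ-++ []      B = sym (⊕-identityˡ (σ B))
  σ-++ (g ∷ A) B = trans (cong (ι g ⊕_) (σ-++ A B)) (sym (⊕-assoc (ι g) (σ A) (σ B)))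

  σ-replicate : ∀ k (g : G m n) → σ (replicate k g) ≡ (+ k) • ι g
  σ-replicate zero    g = refl
  σ-replicate (suc k) g = trans (cong (ι g ⊕_) (σ-replicate k g)) (sym (•-suc k (ι g)))

  infix 4 _≈-_·_+_
  _≈-_·_+_ : G m n → ℕ → ℤ² → ℤ² → Set
  g ≈- x · P + Q = ι g ≈ ((ℤ.- (+ x)) • P) ⊕ Q

  σ-pointwise : ∀ P Q {xs V} → Pointwise (λ x g → g ≈- x · P + Q) xs V →
                σ V ≈ ((ℤ.- (+ sum xs)) • P) ⊕ ((+ length xs) • Q)
  σ-pointwise P Q []                   = ≈-reflexive refl
  σ-pointwise P Q {x ∷ xs} (g≈ ∷ xs~V) =
    ≈-trans (⊕-cong g≈ (σ-pointwise P Q xs~V)) (≈-reflexive (⊕-line P Q x (sum xs) (length xs)))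

  σ-balanced : ∀ (f₁ f₂ : G m n) b {xs V} → Pointwise (λ x g → g ≈- x · ι f₁ + ι f₂) xs V →
               σ (replicate (sum xs) f₁ ++ replicate b f₂ ++ V) ≈ (+ (b + length xs)) • ι f₂
  σ-balanced f₁ f₂ b {xs} {V} xs~V =
    ≈-trans (≈-reflexive expand)
      (≈-trans (⊕-congˡ ((+ sum xs) • ι f₁) (⊕-congˡ ((+ b) • ι f₂) (σ-pointwise (ι f₁) (ι f₂) xs~V)))
        (≈-reflexive (⊕-line-cancel (ι f₁) (ι f₂) (sum xs) b (length xs))))
    where
      expand : σ (replicate (sum xs) f₁ ++ replicate b f₂ ++ V)
             ≡ ((+ sum xs) • ι f₁) ⊕ (((+ b) • ι f₂) ⊕ σ V)
      expand = trans (σ-++ (replicate (sum xs) f₁) _)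
                 (cong₂ _⊕_ (σ-replicate (sum xs) f₁)
                   (trans (σ-++ (replicate b f₂) V) (cong (_⊕ σ V) (σ-replicate b f₂))))

module _ {A : Set} where

  ∣ˢ-respʳ-↭ : ∀ {T L L′ : List A} → T ∣ˢ L → L ↭ L′ → T ∣ˢ L′
  ∣ˢ-respʳ-↭ (R , T++R↭L) L↭L′ = R , ↭-trans T++R↭L L↭L′

  ⊆⇒∣ˢ : ∀ {U L : List A} → U ⊆ L → U ∣ˢ L
  ⊆⇒∣ˢ []                   = [] , ↭-refl
  ⊆⇒∣ˢ {U} (y ∷ʳ U⊆L)       = let R , U++R↭L = ⊆⇒∣ˢ U⊆L in
    y ∷ R , ↭-trans (shift y U R) (↭-prep y U++R↭L)
  ⊆⇒∣ˢ (_∷_ {x = x} refl U⊆L) = let R , U++R↭L = ⊆⇒∣ˢ U⊆L in R , ↭-prep x U++R↭L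

  ⊆-insert : ∀ (L₁ : List A) {L₂ U} x → U ⊆ L₁ ++ L₂ → ∃[ U′ ] (U′ ⊆ L₁ ++ x ∷ L₂ × x ∷ U ↭ U′)
  ⊆-insert []       x U⊆L = x ∷ _ , refl ∷ U⊆L , ↭-refl
  ⊆-insert (y ∷ L₁) x (_ ∷ʳ U⊆L) = let U′ , U′⊆ , x∷U↭U′ = ⊆-insert L₁ x U⊆L in
    U′ , y ∷ʳ U′⊆ , x∷U↭U′
  ⊆-insert (y ∷ L₁) x (refl ∷ U⊆L) = let U′ , U′⊆ , x∷U↭U′ = ⊆-insert L₁ x U⊆L in
    y ∷ U′ , refl ∷ U′⊆ , ↭-trans (↭-swap x y ↭-refl) (↭-prep y x∷U↭U′)

  ∣ˢ⇒⊆ : ∀ {T L : List A} → T ∣ˢ L → ∃[ U ] (U ⊆ L × T ↭ U)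
  ∣ˢ⇒⊆ {[]}    {L} _ = [] , minimum L , ↭-refl
  ∣ˢ⇒⊆ {t ∷ T} (R , t∷T++R↭L) with ∈-∃++ (∈-resp-↭ t∷T++R↭L (here refl))
  ... | L₁ , L₂ , refl =
    let U , U⊆ , T↭U = ∣ˢ⇒⊆ (R , drop-mid [] L₁ t∷T++R↭L)
        U′ , U′⊆ , t∷U↭U′ = ⊆-insert L₁ t U⊆
    in U′ , U′⊆ , ↭-trans (↭-prep t T↭U) t∷U↭U′

  ⊆-++⁻ : ∀ (B : List A) {C U} → U ⊆ B ++ C → ∃₂ λ U₁ U₂ → U ≡ U₁ ++ U₂ × U₁ ⊆ B × U₂ ⊆ C
  ⊆-++⁻ []      U⊆C = [] , _ , refl , [] , U⊆C
  ⊆-++⁻ (y ∷ B) (_ ∷ʳ U⊆) with ⊆-++⁻ B U⊆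
  ... | U₁ , U₂ , refl , U₁⊆B , U₂⊆C = U₁ , U₂ , refl , y ∷ʳ U₁⊆B , U₂⊆C
  ⊆-++⁻ (y ∷ B) (refl ∷ U⊆) with ⊆-++⁻ B U⊆
  ... | U₁ , U₂ , refl , U₁⊆B , U₂⊆C = y ∷ U₁ , U₂ , refl , refl ∷ U₁⊆B , U₂⊆C

  ⊆-replicate⁻ : ∀ {k x} {U : List A} → U ⊆ replicate k x → U ≡ replicate (length U) x
  ⊆-replicate⁻ {zero}  []           = refl
  ⊆-replicate⁻ {suc k} (_ ∷ʳ U⊆)    = ⊆-replicate⁻ U⊆
  ⊆-replicate⁻ {suc k} (refl ∷ U⊆)  = cong (_ ∷_) (⊆-replicate⁻ U⊆)

  replicate-mono-⊆ : ∀ {a b} (x : A) → a ≤ b → replicate a x ⊆ replicate b x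
  replicate-mono-⊆ {b = b} x z≤n     = minimum (replicate b x)
  replicate-mono-⊆         x (s≤s a≤b) = refl ∷ replicate-mono-⊆ x a≤b

  ∣ˢ-replicate-++⁻ : ∀ {T : List A} x y p q L → T ∣ˢ (replicate p x ++ replicate q y ++ L) →
                     ∃[ a ] ∃[ b ] ∃[ U ] (a ≤ p × U ⊆ L × T ↭ replicate a x ++ replicate b y ++ U)
  ∣ˢ-replicate-++⁻ {T} x y p q L T∣ with ∣ˢ⇒⊆ T∣
  ... | V , V⊆ , T↭V with ⊆-++⁻ (replicate p x) V⊆
  ... | V₁ , V₂₃ , refl , V₁⊆ , V₂₃⊆ with ⊆-++⁻ (replicate q y) V₂₃⊆
  ... | V₂ , U , refl , V₂⊆ , U⊆L =
    length V₁ , length V₂ , U ,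
    subst (length V₁ ≤_) (length-replicate p) (length-mono-≤ V₁⊆) , U⊆L ,
    subst (λ V → T ↭ V) (cong₂ (λ V₁ V₂ → V₁ ++ V₂ ++ U) (⊆-replicate⁻ V₁⊆) (⊆-replicate⁻ V₂⊆)) T↭V

module _ {A B : Set} {R : A → B → Set} where

  Pointwise-⊆⁻ : ∀ {xs gs U} → Pointwise R xs gs → U ⊆ gs → ∃[ ys ] (ys ⊆ xs × Pointwise R ys U)
  Pointwise-⊆⁻ []       []            = [] , [] , []
  Pointwise-⊆⁻ (r ∷ rs) (_ ∷ʳ U⊆)    = let ys , ys⊆ , ys~U = Pointwise-⊆⁻ rs U⊆ in ys , _ ∷ʳ ys⊆ , ys~U
  Pointwise-⊆⁻ (r ∷ rs) (refl ∷ U⊆)  = let ys , ys⊆ , ys~U = Pointwise-⊆⁻ rs U⊆ in _ ∷ ys , refl ∷ ys⊆ , r ∷ ys~U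

  Pointwise-take : ∀ k {xs ys} → Pointwise R xs ys → Pointwise R (take k xs) (take k ys)
  Pointwise-take zero    _        = []
  Pointwise-take (suc k) []       = []
  Pointwise-take (suc k) (r ∷ rs) = r ∷ Pointwise-take k rs

length≤sum : ∀ {xs} → All (1 ≤_) xs → length xs ≤ sum xs
length≤sum []            = z≤n
length≤sum (1≤x ∷ 1≤xs) = +-mono-≤ 1≤x (length≤sum 1≤xs)

sum-take+length-drop≤sum : ∀ k {xs} → All (1 ≤_) xs → sum (take k xs) + length (drop k xs) ≤ sum xs
sum-take+length-drop≤sum k {xs} 1≤xs = begin
  sum (take k xs) + length (drop k xs) ≤⟨ +-monoʳ-≤ (sum (take k xs)) (length≤sum (drop⁺ k 1≤xs)) ⟩
  sum (take k xs) + sum (drop k xs)    ≡⟨ sum-++ (take k xs) (drop k xs) ⟨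
  sum (take k xs ++ drop k xs)         ≡⟨ cong sum (take++drop≡id k xs) ⟩
  sum xs                               ∎
  where open ≤-Reasoning

sum-mono-∣ˢ : ∀ {ys xs} → ys ∣ˢ xs → sum ys ≤ sum xs
sum-mono-∣ˢ {ys} {xs} (zs , ys++zs↭xs) = begin
  sum ys           ≤⟨ m≤m+n (sum ys) (sum zs) ⟩
  sum ys + sum zs  ≡⟨ sum-++ ys zs ⟨
  sum (ys ++ zs)   ≡⟨ sum-↭ ys++zs↭xs ⟩
  sum xs           ∎
  where open ≤-Reasoning

∣ˢ∧sum≡⇒↭ : ∀ {ys xs} → ys ∣ˢ xs → All (1 ≤_) xs → sum ys ≡ sum xs → ys ↭ xs
∣ˢ∧sum≡⇒↭ {ys} {xs} (zs , ys++zs↭xs) 1≤xs Σys≡Σxs =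
  subst (_↭ xs) (trans (cong (ys ++_) (zero-sum⇒[] 1≤zs Σzs≡0)) (++-identityʳ ys)) ys++zs↭xs
  where
    1≤zs : All (1 ≤_) zs
    1≤zs = ++⁻ʳ ys (All-resp-↭ (↭-sym ys++zs↭xs) 1≤xs)

    Σzs≡0 : sum zs ≡ 0
    Σzs≡0 = +-cancelˡ-≡ (sum ys) (sum zs) 0 (begin
      sum ys + sum zs ≡⟨ sum-++ ys zs ⟨
      sum (ys ++ zs)  ≡⟨ sum-↭ ys++zs↭xs ⟩
      sum xs          ≡⟨ Σys≡Σxs ⟨
      sum ys          ≡⟨ +-identityʳ (sum ys) ⟨
      sum ys + 0      ∎)
      where open ≡-Reasoning

    zero-sum⇒[] : ∀ {zs} → All (1 ≤_) zs → sum zs ≡ 0 → zs ≡ []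
    zero-sum⇒[] []            _  = refl
    zero-sum⇒[] (s≤s _ ∷ _)   ()

≤∧≤∧+≡+⇒≡∧≡ : ∀ {x y a b} → x ≤ a → y ≤ b → x + y ≡ a + b → x ≡ a × y ≡ b
≤∧≤∧+≡+⇒≡∧≡ {x} {y} {a} {b} x≤a y≤b x+y≡a+b = x≡a , +-cancelˡ-≡ x y b (trans x+y≡a+b (cong (_+ b) (sym x≡a)))
  where
    x≡a : x ≡ a
    x≡a = ≤-antisym x≤a (+-cancelʳ-≤ b a x (begin
      a + b ≡⟨ x+y≡a+b ⟨
      x + y ≤⟨ +-monoʳ-≤ x y≤b ⟩
      x + b ∎))
      where open ≤-Reasoning

length-replicate-++ : ∀ {A : Set} a b (x y : A) V → length (replicate a x ++ replicate b y ++ V) ≡ a + (b + length V)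
length-replicate-++ a b x y V =
  trans (length-++ (replicate a x))
    (cong₂ _+_ (length-replicate a) (trans (length-++ (replicate b y)) (cong (_+ length V) (length-replicate b))))

module _ {m n : ℕ} where

  open Modulo m n

  Witness : ℤ² → List (G m n) → List (G m n) → Set
  Witness g target T = ∃[ T₁ ] (T₁ ∣ˢ T × σ T₁ ≈ g × (length T₁ < length T ⊎ T ↭ target))

  Witness⇒conclusion : ∀ {g target T} → Witness g target T →
    (∃[ T₁ ] (T₁ ∣ˢ T × ≈[ m , n ] (σ T₁) g)) ×
    ((∀ T₁ → T₁ ∣ˢ T → ¬ (T₁ ↭ T) → ¬ ≈[ m , n ] (σ T₁) g) → T ↭ target)
  Witness⇒conclusion (T₁ , T₁∣T , mod σT₁≈g , inj₁ |T₁|<|T|) =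
    (T₁ , T₁∣T , σT₁≈g) ,
    λ minimal → ⊥-elim (minimal T₁ T₁∣T (λ T₁↭T → <-irrefl (↭-length T₁↭T) |T₁|<|T|) σT₁≈g)
  Witness⇒conclusion (T₁ , T₁∣T , mod σT₁≈g , inj₂ T↭target) = (T₁ , T₁∣T , σT₁≈g) , λ _ → T↭target

module Witnesses {p n : ℕ} (f₁ f₂ : G (suc p) n) where

  private
    m : ℕ
    m = suc p

  open Modulo m n

  module _ {ε : ℕ} {xs : List ℕ} {gs : List (G m n)}
           (2≤m : 2 ≤ m) (ε≤m : ε ≤ m) (|xs|≡m∸ε : length xs ≡ m ∸ ε) (|gs|≡|xs| : length gs ≡ length xs)
           (1≤xs : All (1 ≤_) xs) (Σxs≡p : sum xs ≡ p)
           {a b : ℕ} {T U : List (G m n)} {ys : List ℕ}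
           (T↭ : T ↭ replicate a f₁ ++ replicate b f₂ ++ U)
           (U⊆gs : U ⊆ gs) (ys⊆xs : ys ⊆ xs) (ys~U : Pointwise (λ x g → g ≈- x · ι f₁ + ι f₂) ys U)
           (|T|≥2m∸1 : 2 * m ∸ 1 ≤ length T)
    where

    private
      c : ℕ
      c = length ys

      target : List (G m n)
      target = replicate p f₁ ++ replicate ε f₂ ++ gs

      |U|≡c : length U ≡ c
      |U|≡c = sym (Pointwise-length ys~U)

      |T|≡a+b+c : length T ≡ a + (b + c)
      |T|≡a+b+c = trans (↭-length T↭) (trans (length-replicate-++ a b f₁ f₂ U) (cong (λ l → a + (b + l)) |U|≡c))

      p+m≤|T| : p + m ≤ length T
      p+m≤|T| = subst (_≤ length T) (cong (_+_ p) (+-identityʳ m)) |T|≥2m∸1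

      p+m≤a+b+c : p + m ≤ a + (b + c)
      p+m≤a+b+c = subst (p + m ≤_) |T|≡a+b+c p+m≤|T|

      1≤ys : All (1 ≤_) ys
      1≤ys = All-resp-⊆ ys⊆xs 1≤xs

      Σys≤p : sum ys ≤ p
      Σys≤p = subst (sum ys ≤_) Σxs≡p (sum-mono-∣ˢ (⊆⇒∣ˢ ys⊆xs))

      c≤m : c ≤ m
      c≤m = ≤-trans (length-mono-≤ ys⊆xs) (subst (_≤ m) (sym |xs|≡m∸ε) (m∸n≤m m ε))

    full-prefix⇒target : ∀ k → sum (take k ys) ≡ a → m ∸ k ≡ b → k ≡ c → T ↭ target
    full-prefix⇒target k Σ≡a m∸k≡b refl =
      subst₂ (λ a′ b′ → T ↭ replicate a′ f₁ ++ replicate b′ f₂ ++ gs) a≡p b≡ε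
        (subst (λ U′ → T ↭ replicate a f₁ ++ replicate b f₂ ++ U′) U≡gs T↭)
      where
        Σys≡a : sum ys ≡ a
        Σys≡a = trans (cong sum (sym (take-all c ys ≤-refl))) Σ≡a

        b+c≡m : b + c ≡ m
        b+c≡m = trans (cong (_+ c) (sym m∸k≡b)) (m∸n+n≡m c≤m)

        p≤a : p ≤ a
        p≤a = +-cancelʳ-≤ m p a (subst (p + m ≤_) (cong (_+_ a) b+c≡m) p+m≤a+b+c)

        a≡p : a ≡ p
        a≡p = ≤-antisym (subst (_≤ p) Σys≡a Σys≤p) p≤a

        ys↭xs : ys ↭ xs
        ys↭xs = ∣ˢ∧sum≡⇒↭ (⊆⇒∣ˢ ys⊆xs) 1≤xs (trans Σys≡a (trans a≡p (sym Σxs≡p)))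

        U≡gs : U ≡ gs
        U≡gs = ≋⇒≡ (to-≋ (trans |U|≡c (trans (↭-length ys↭xs) (sym |gs|≡|xs|))) U⊆gs)

        b≡ε : b ≡ ε
        b≡ε = trans (sym m∸k≡b) (trans (cong (m ∸_) (trans (↭-length ys↭xs) |xs|≡m∸ε)) (m∸[m∸n]≡n ε≤m))

    prefix-witness : ∀ k → k ≤ c → m ∸ k ≤ b → sum (take k ys) ≤ a → Witness ((+ m) • ι f₂) target T
    prefix-witness k k≤c m∸k≤b Σₖ≤a = T₁ , T₁∣T , σT₁≈mf₂ , shorter-or-target
      where
        Σₖ : ℕ
        Σₖ = sum (take k ys)

        T₁ : List (G m n)
        T₁ = replicate Σₖ f₁ ++ replicate (m ∸ k) f₂ ++ take k U

        T₁∣T : T₁ ∣ˢ T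
        T₁∣T = ∣ˢ-respʳ-↭
          (⊆⇒∣ˢ (++⁺ (replicate-mono-⊆ f₁ Σₖ≤a) (++⁺ (replicate-mono-⊆ f₂ m∸k≤b) (take-⊆ k U))))
          (↭-sym T↭)

        |take-k-ys|≡k : length (take k ys) ≡ k
        |take-k-ys|≡k = trans (length-take k ys) (m≤n⇒m⊓n≡m k≤c)

        σT₁≈mf₂ : σ T₁ ≈ (+ m) • ι f₂
        σT₁≈mf₂ = subst (λ j → σ T₁ ≈ (+ j) • ι f₂)
          (trans (cong (_+_ (m ∸ k)) |take-k-ys|≡k) (m∸n+n≡m (≤-trans k≤c c≤m)))
          (σ-balanced f₁ f₂ (m ∸ k) (Pointwise-take k ys~U))

        |T₁|≡ : length T₁ ≡ Σₖ + ((m ∸ k) + k)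
        |T₁|≡ = trans (length-replicate-++ Σₖ (m ∸ k) f₁ f₂ (take k U))
          (cong (λ l → Σₖ + ((m ∸ k) + l))
            (trans (length-take k U) (m≤n⇒m⊓n≡m (subst (k ≤_) (sym |U|≡c) k≤c))))

        |T₁|≤|T| : Σₖ + ((m ∸ k) + k) ≤ a + (b + c)
        |T₁|≤|T| = +-mono-≤ Σₖ≤a (+-mono-≤ m∸k≤b k≤c)

        shorter-or-target : length T₁ < length T ⊎ T ↭ target
        shorter-or-target with m≤n⇒m<n∨m≡n |T₁|≤|T|
        ... | inj₁ |T₁|<|T| = inj₁ (subst₂ _<_ (sym |T₁|≡) (sym |T|≡a+b+c) |T₁|<|T|)
        ... | inj₂ |T₁|≡|T| =
          let Σₖ≡a , rest = ≤∧≤∧+≡+⇒≡∧≡ Σₖ≤a (+-mono-≤ m∸k≤b k≤c) |T₁|≡|T|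
              m∸k≡b , k≡c = ≤∧≤∧+≡+⇒≡∧≡ m∸k≤b k≤c rest
          in inj₂ (full-prefix⇒target k Σₖ≡a m∸k≡b k≡c)

    power-witness : (m ≤ a → (+ m) • ι f₁ ≈ (+ m) • ι f₂) → b + c < m → Witness ((+ m) • ι f₂) target T
    power-witness m≤a⇒mf₁≈mf₂ b+c<m =
      replicate m f₁ ,
      ∣ˢ-respʳ-↭ (⊆⇒∣ˢ (++⁺ʳ _ (replicate-mono-⊆ f₁ m≤a))) (↭-sym T↭) ,
      ≈-trans (≈-reflexive (σ-replicate m f₁)) (m≤a⇒mf₁≈mf₂ m≤a) ,
      inj₁ (subst (_< length T) (sym (length-replicate m)) (≤-trans (+-monoˡ-≤ m (≤-pred 2≤m)) p+m≤|T|))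
      where
        m≤a : m ≤ a
        m≤a = +-cancelʳ-≤ p m a (begin
          m + p       ≡⟨ +-comm m p ⟩
          p + m       ≤⟨ p+m≤a+b+c ⟩
          a + (b + c) ≤⟨ +-monoʳ-≤ a (≤-pred b+c<m) ⟩
          a + p       ∎)
          where open ≤-Reasoning

    head-sum≤a : b ≤ m → m ≤ b + c → sum (take (m ∸ b) ys) ≤ a
    head-sum≤a b≤m m≤b+c = +-cancelʳ-≤ D (sum (take k ys)) a (begin
        sum (take k ys) + D ≤⟨ sum-take+length-drop≤sum k 1≤ys ⟩
        sum ys              ≤⟨ Σys≤p ⟩
        p                   ≤⟨ +-cancelʳ-≤ m p (a + D) (subst (p + m ≤_) a+b+c≡a+D+m p+m≤a+b+c) ⟩
        a + D               ∎)
      where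
        open ≤-Reasoning
        k D : ℕ
        k = m ∸ b
        D = length (drop k ys)

        c≡k+D : c ≡ k + D
        c≡k+D = trans (sym (m+[n∸m]≡n (m≤n+o⇒m∸n≤o m b m≤b+c))) (cong (_+_ k) (sym (length-drop k ys)))

        a+b+c≡a+D+m : a + (b + c) ≡ a + D + m
        a+b+c≡a+D+m = begin-equality
          a + (b + c)       ≡⟨ cong (λ l → a + (b + l)) c≡k+D ⟩
          a + (b + (k + D)) ≡⟨ cong (_+_ a) (sym (+-assoc b k D)) ⟩
          a + ((b + k) + D) ≡⟨ cong (λ l → a + (l + D)) (m+[n∸m]≡n b≤m) ⟩
          a + (m + D)       ≡⟨ cong (_+_ a) (+-comm m D) ⟩
          a + (D + m)       ≡⟨ +-assoc a D m ⟨
          a + D + m         ∎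

    witness : (m ≤ a → (+ m) • ι f₁ ≈ (+ m) • ι f₂) → Witness ((+ m) • ι f₂) target T
    witness m≤a⇒mf₁≈mf₂ with m ≤? b + c | m ≤? b
    ... | no  m≰b+c | _       = power-witness m≤a⇒mf₁≈mf₂ (≰⇒> m≰b+c)
    ... | yes _     | yes m≤b = prefix-witness 0 z≤n m≤b z≤n
    ... | yes m≤b+c | no  m≰b =
      prefix-witness (m ∸ b) (m≤n+o⇒m∸n≤o m b m≤b+c) (≤-reflexive (m∸[m∸n]≡n b≤m)) (head-sum≤a b≤m m≤b+c)
      where
        b≤m : b ≤ m
        b≤m = <⇒≤ (≰⇒> m≰b)

lemma5p5 :
    (m n : ℕ) → 2 ≤ m → 1 ≤ n →
    (f₁ f₂ : G m n) (s ε : ℕ) (xs : List ℕ) (gs : List (G m n)) (S : List (G m n)) →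
    MinimalZeroSum m n S →
    length S ≡ m + m * n ∸ 1 →
    S ↭ (replicate (s * m ∸ 1) f₁ ++ replicate ((n ∸ s) * m + ε) f₂ ++ gs) →
    -- (a)
    Generates m n f₁ f₂ →
    IsOrder m n f₂ (m * n) →
    (∃[ k ] (IsOrder m n f₁ k × m < k)) →
    -- (b)
    1 ≤ ε → ε ≤ m ∸ 1 → 1 ≤ s → s ≤ n ∸ 1 →
    -- (c) gs = ∏ (-xᵢ f₁ + f₂), i ∈ [1, m-ε]
    length xs ≡ m ∸ ε →
    All (λ x → 1 ≤ x × x ≤ m ∸ 1) xs →
    sum xs ≡ m ∸ 1 →
    Pointwise (λ x g → ≈[ m , n ] (ι g) (((ℤ.- (+ x)) • ι f₁) ⊕ ι f₂)) xs gs →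
    -- (d)
    (s ≡ 1 ⊎ ≈[ m , n ] ((+ m) • ι f₁) ((+ m) • ι f₂)) →
    (n ≡ 2 → s ≡ 1 × ≈[ m , n ] ((+ m) • ι f₁) ((+ m) • ι f₂)) →
    -- (e)
    (2 ≤ ε ⊎ ¬ ≈[ m , n ] ((+ m) • ι f₁) ((+ m) • ι f₂)) →
    -- T ∣ S with |T| ≥ 2m - 1
    (T : List (G m n)) → T ∣ˢ S → 2 * m ∸ 1 ≤ length T →
    (∃[ T₁ ] (T₁ ∣ˢ T × ≈[ m , n ] (σ T₁) ((+ m) • ι f₂)))
    × ((∀ T₁ → T₁ ∣ˢ T → ¬ (T₁ ↭ T) → ¬ ≈[ m , n ] (σ T₁) ((+ m) • ι f₂)) →
       T ↭ (replicate (m ∸ 1) f₁ ++ replicate ε f₂ ++ gs))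
lemma5p5 (suc p) n 2≤m _ f₁ f₂ s ε xs gs S _ _ S↭ _ _ _ _ ε≤p _ _ |xs|≡m∸ε xs∈[1,p] Σxs≡p xs~gs s≡1⊎mf₁≈mf₂ _ _
         T T∣S |T|≥2m∸1
  with ∣ˢ-replicate-++⁻ f₁ f₂ (s * suc p ∸ 1) _ gs (∣ˢ-respʳ-↭ T∣S S↭)
... | a , b , U , a≤sm∸1 , U⊆gs , T↭ with Pointwise-⊆⁻ (Pointwise.map Modulo.mod xs~gs) U⊆gs
... | ys , ys⊆xs , ys~U =
  Witness⇒conclusion
    (witness 2≤m (m≤n⇒m≤1+n ε≤p) |xs|≡m∸ε (sym (Pointwise-length xs~gs)) (All.map proj₁ xs∈[1,p]) Σxs≡p
             T↭ U⊆gs ys⊆xs ys~U |T|≥2m∸1 m≤a⇒mf₁≈mf₂)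
  where
    open Modulo (suc p) n
    open Witnesses f₁ f₂

    m≤a⇒mf₁≈mf₂ : suc p ≤ a → (+ suc p) • ι f₁ ≈ (+ suc p) • ι f₂
    m≤a⇒mf₁≈mf₂ m≤a = [ ⊥-elim ∘ s≢1 , mod ]′ s≡1⊎mf₁≈mf₂
      where
        s≢1 : s ≢ 1
        s≢1 s≡1 = 1+n≰n (begin
          suc p         ≤⟨ m≤a ⟩
          a             ≤⟨ subst (λ s → a ≤ s * suc p ∸ 1) s≡1 a≤sm∸1 ⟩
          1 * suc p ∸ 1 ≡⟨ +-identityʳ p ⟩
          p             ∎)
          where open ≤-Reasoning
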